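{- Let $k\ge 2$ be an integer, let $(G,\sigma)$ be a signed graph, and let $\beta$ be a $\mathbb{Z}_{4k}$-pc-boundary of $2G$ such that $\beta(v)\equiv 2k\cdot p^+(v)\pmod{4k}$ for every $v\in V(G)$. If $2G$ admits a strongly connected $(4k,\beta)$-orientation, then $\phi_c(G,\sigma)<\frac{2k}{k-1}$.
   Context: Graphs may have parallel edges but no loops. A signed graph $(G,\sigma)$ is a graph with $\sigma:E(G)\to\{+1,-1\}$; $p^+(v)$ is the number of positive edges incident with $v$. $2G$ is obtained from $G$ by replacing every edge by two parallel edges. For a positive integer $m$, a $\mathbb{Z}_{2m}$-pc-boundary of a graph $H$ is a map $\beta:V(H)\to\{0,\pm1,\dots,\pm m\}$ with $\beta(v)\equiv d_H(v)\pmod 2$ for all $v$ and $\sum_v\beta(v)\equiv 0\pmod{2m}$; a $(2m,\beta)$-orientation is an orientation $D$ of $H$ with $d^+_D(v)-d^-_D(v)\equiv\beta(v)\pmod{2m}$ for every $v$. An orientation $D$ is strongly connected if for every nonempty proper subset $S\subset V(H)$ at least one edge is directed out of $S$ and at least one into $S$. For positive integers $p,q$ with $p$ even, a circular $\frac pq$-flow in $(G,\sigma)$ is a pair $(D,f)$ with $D$ an orientation of $G$ and $f:E(G)\to\mathbb{Z}$ such that $|f(e)|\in\{q,\dots,p-q\}$ for each positive edge, $|f(e)|\in\{0,\dots,\frac p2-q\}\cup\{\frac p2+q,\dots,p-1\}$ for each negative edge, and $\sum_{(v,w)\in D}f(vw)-\sum_{(u,v)\in D}f(uv)\equiv0\pmod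 p$ for each vertex $v$. The circular flow index $\phi_c(G,\sigma)$ is the minimum $\frac pq$ such that $(G,\sigma)$ admits a circular $\frac pq$-flow. -}

module Defs where

open import Data.Nat as ℕ using (ℕ; suc)
open import Data.Integer as ℤ using (ℤ; +_; _-_; _*_; _≤_; -_; ∣_∣)
open import Data.Integer.Divisibility using (_∣_)
open import Data.Fin using (Fin; splitAt; _≟_)
open import Data.List using (List; foldr; map; allFin)
open import Data.Bool using (Bool; true; false; if_then_else_)
open import Data.Sign using (Sign)
open import Data.Product using (_×_; _,_; proj₁; proj₂; ∃; ∃-syntax)
open import Data.Sum using (_⊎_; [_,_]′)
open import Relation.Nullary using (¬_)
open import Relation.Nullary.Decidable using (⌊_⌋)
open import Relation.Binary.PropositionalEquality using (_≡_; _≢_)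

record Graph : Set where
  field
    n     : ℕ
    m     : ℕ
    ends  : Fin m → Fin n × Fin n
    loopless : ∀ e → proj₁ (ends e) ≢ proj₂ (ends e)

open Graph public

V : Graph → Set
V G = Fin (n G)

E : Graph → Set
E G = Fin (m G)

double : Graph → Graph
double G = record
  { n = n G
  ; m = m G ℕ.+ m G
  ; ends = λ e → [ ends G , ends G ]′ (splitAt (m G) e)
  ; loopless = λ e → lemma (splitAt (m G) e)
  }
  where
  lemma : (x : Fin (m G) ⊎ Fin (m G)) →
          proj₁ ([ ends G , ends G ]′ x) ≢ proj₂ ([ ends G , ends G ]′ x)
  lemma (Data.Sum.inj₁ e) = loopless G e
  lemma (Data.Sum.inj₂ e) = loopless G e

Σℤ : (k : ℕ) → (Fin k → ℤ) → ℤ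
Σℤ k g = foldr ℤ._+_ (+ 0) (map g (allFin k))

[_] : Bool → ℤ
[ b ] = if b then + 1 else + 0

_==_ : ∀ {k} → Fin k → Fin k → Bool
x == y = ⌊ x ≟ y ⌋

_≡_[mod_] : ℤ → ℤ → ℕ → Set
a ≡ b [mod M ] = (+ M) ∣ (a - b)

deg : (G : Graph) → V G → ℤ
deg G v = Σℤ (m G) (λ e → [ proj₁ (ends G e) == v ] ℤ.+ [ proj₂ (ends G e) == v ])

Signature : Graph → Set
Signature G = E G → Sign

pplus : (G : Graph) → Signature G → V G → ℤ
pplus G σ v = Σℤ (m G) (λ e → isPos (σ e) ℤ.* ([ proj₁ (ends G e) == v ] ℤ.+ [ proj₂ (ends G e) == v ]))
  where
  isPos : Sign → ℤ
  isPos Sign.+ = + 1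
  isPos Sign.- = + 0

Orientation : Graph → Set
Orientation G = E G → Bool

tail head : (G : Graph) → Orientation G → E G → V G
tail G D e = if D e then proj₁ (ends G e) else proj₂ (ends G e)
head G D e = if D e then proj₂ (ends G e) else proj₁ (ends G e)

netOut : (G : Graph) → Orientation G → V G → ℤ
netOut G D v = Σℤ (m G) (λ e → [ tail G D e == v ] - [ head G D e == v ])

-- Z_{2M}-pc-boundary of H (here  2M  is the modulus, M = the "m" of the paper)
record PCBoundary (M : ℕ) (H : Graph) (β : V H → ℤ) : Set where
  field
    bounded : ∀ v → (- (+ M) ≤ β v) × (β v ≤ + M)
    parity  : ∀ v → β v ≡ deg H v [mod 2 ]
    total   : Σℤ (n H) β ≡ + 0 [mod (2 ℕ.* M) ]

IsBetaOrientation : (N : ℕ) (H : Graph) (β : V H → ℤ) → Orientation H → Set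
IsBetaOrientation N H β D = ∀ v → netOut H D v ≡ β v [mod N ]

StronglyConnected : (H : Graph) → Orientation H → Set
StronglyConnected H D =
  (S : V H → Bool) → (∃[ v ] S v ≡ true) → (∃[ w ] S w ≡ false) →
    (∃[ e ] (S (tail H D e) ≡ true × S (head H D e) ≡ false))
  × (∃[ e ] (S (tail H D e) ≡ false × S (head H D e) ≡ true))

-- circular p/q-flow with p = 2h (p even)
record CircularFlow (G : Graph) (σ : Signature G) (h q : ℕ) : Set where
  field
    D : Orientation G
    f : E G → ℤ
    positive : ∀ e → σ e ≡ Sign.+ →
      (+ q ≤ + ∣ f e ∣) × (+ ∣ f e ∣ ≤ + (2 ℕ.* h) - + q)
    negative : ∀ e → σ e ≡ Sign.- →
      (+ ∣ f e ∣ ≤ + h - + q)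
      ⊎ ((+ h ℤ.+ + q ≤ + ∣ f e ∣) × (+ ∣ f e ∣ ≤ + (2 ℕ.* h) - + 1))
    conservation : ∀ v →
      Σℤ (m G) (λ e → [ tail G D e == v ] ℤ.* f e - [ head G D e == v ] ℤ.* f e)
        ≡ + 0 [mod (2 ℕ.* h) ]

-- φ_c(G,σ) < a/b  (a, b positive): since φ_c is the minimum of the p/q admitting
-- a circular p/q-flow, this says some circular p/q-flow (p = 2h even, p,q ≥ 1) has p/q < a/b.
φc<_/_ : ℕ → ℕ → (G : Graph) → Signature G → Set
(φc< a / b) G σ = ∃[ h ] ∃[ q ] (1 ℕ.≤ h × 1 ℕ.≤ q × (2 ℕ.* h) ℕ.* b ℕ.< a ℕ.* q × CircularFlow G σ h q)

module Submission where

-- Strong connectivity puts every edge of 2G on a directed closed walk; summing these walks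
-- gives a positive circulation c, and N - c (N = 1 + max c) is a flow on 2G whose boundary is
-- N times the net outdegree of D and whose values lie in [0, N - 1].  Adding the two parallel
-- copies of each edge gives a flow y on G with |y| ≤ 2N - 2 and boundary N · netOut.  With
-- h = 2kN and q = 2(k - 1)N + 1, adding h on the positive edges moves their values into
-- [q, 2h - q] and leaves the negative ones in [0, h - q]; the boundary gains h times the net
-- positive degree, which has the parity of p⁺, and N · netOut ≡ N · 2k · p⁺ = h · p⁺ modulo
-- 2h, so the result is a circular 2h/q-flow.

open import Defs

module Flows where
  open import Data.Bool using (Bool; true; false; if_then_else_)
  open import Data.Bool.Properties using (if-float)
  open import Data.Fin using (Fin; zero; suc; _↑ˡ_; _↑ʳ_; _≟_)
  open import Data.Fin.Properties using (splitAt-↑ˡ; splitAt-↑ʳ)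
  open import Data.Fin.Subset using (Subset; _∉_; ⁅_⁆; ∁) renaming (∣_∣ to ∣_∣ₛ; _-_ to _∖_)
  open import Data.Fin.Subset.Properties
    using (_∈?_; x∈⁅x⁆; x∈⁅y⁆⇒x≡y; x∈p⇒x∉∁p; x∉∁p⇒x∈p; p─q⊆p; x∈p∧x≢y⇒x∈p-y; x∈p⇒∣p-x∣<∣p∣)
  open import Data.Integer using (ℤ; +_; -_; _+_; _-_; _*_; ∣_∣; _≤_; +≤+; -1ℤ)
  open import Data.Integer.Divisibility using (_∣_; *-monoʳ-∣)
  import Data.Integer.Divisibility.Signed as Signed
  import Data.Integer.Properties as ℤₚ
  open import Data.Integer.Tactic.RingSolver using (solve-∀)
  open import Data.List using (List; []; _∷_; foldr; tabulate; allFin)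
  open import Data.List.Membership.Propositional.Properties using (∈-allFin)
  open import Data.List.Properties using (map-tabulate)
  open import Data.List.Relation.Unary.All as All using (All; []; _∷_)
  open import Data.Nat as ℕ using (ℕ)
  import Data.Nat.Properties as ℕₚ
  open import Data.Nat.Tactic.RingSolver using () renaming (solve-∀ to ℕ-solve-∀)
  open import Data.Product using (Σ-syntax; ∃-syntax; _×_; _,_; proj₁; proj₂)
  open import Data.Sign using (Sign)
  open import Data.Sum using (_⊎_; inj₁; [_,_]′)
  open import Data.Vec using (lookup)
  open import Data.Vec.Properties using ([]=⇒lookup; lookup⇒[]=)
  open import Function using (id)
  open import Level using (0ℓ)
  open import Relation.Binary.Bundles using (Setoid)
  open import Relation.Binary.PropositionalEquality
    using (_≡_; refl; sym; trans; cong; cong₂; subst; subst₂; module ≡-Reasoning)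
  import Relation.Binary.Reasoning.Setoid as SetoidReasoning
  open import Relation.Nullary using (yes; no; contradiction)
  open import Algebra.Properties.Semiring.Sum ℤₚ.+-*-semiring
    using (sum; sum-cong-≗; ∑-distrib-+; *-distribˡ-sum; sum-replicate-zero)

  i+j-i≡j : ∀ (i j : ℤ) → (i + j) - i ≡ j
  i+j-i≡j = solve-∀

  [i-j]+[j-k]≡i-k : ∀ (i j k : ℤ) → (i - j) + (j - k) ≡ i - k
  [i-j]+[j-k]≡i-k = solve-∀

  i*k-j*k≡k*[i-j] : ∀ (i j k : ℤ) → i * k - j * k ≡ k * (i - j)
  i*k-j*k≡k*[i-j] = solve-∀

  Σℤ≡sum : ∀ k (f : Fin k → ℤ) → Σℤ k f ≡ sum f
  Σℤ≡sum k f = trans (cong (foldr _+_ (+ 0)) (map-tabulate id f)) (foldr-tabulate k f)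
    where
    foldr-tabulate : ∀ k (f : Fin k → ℤ) → foldr _+_ (+ 0) (tabulate f) ≡ sum f
    foldr-tabulate ℕ.zero    f = refl
    foldr-tabulate (ℕ.suc k) f = cong (_+_ (f zero)) (foldr-tabulate k (λ i → f (suc i)))

  Σℤ-cong : ∀ k {f g : Fin k → ℤ} → (∀ i → f i ≡ g i) → Σℤ k f ≡ Σℤ k g
  Σℤ-cong k {f} {g} f≗g
    rewrite Σℤ≡sum k f | Σℤ≡sum k g = sum-cong-≗ f≗g

  Σℤ-distrib-+ : ∀ k (f g : Fin k → ℤ) → Σℤ k (λ i → f i + g i) ≡ Σℤ k f + Σℤ k g
  Σℤ-distrib-+ k f g
    rewrite Σℤ≡sum k (λ i → f i + g i) | Σℤ≡sum k f | Σℤ≡sum k g = ∑-distrib-+ f g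

  Σℤ-*ˡ : ∀ k a (f : Fin k → ℤ) → Σℤ k (λ i → a * f i) ≡ a * Σℤ k f
  Σℤ-*ˡ k a f
    rewrite Σℤ≡sum k (λ i → a * f i) | Σℤ≡sum k f = sym (*-distribˡ-sum a f)

  Σℤ-split : ∀ a b (f : Fin (a ℕ.+ b) → ℤ) →
             Σℤ (a ℕ.+ b) f ≡ Σℤ a (λ i → f (i ↑ˡ b)) + Σℤ b (λ j → f (a ↑ʳ j))
  Σℤ-split a b f
    rewrite Σℤ≡sum (a ℕ.+ b) f | Σℤ≡sum a (λ i → f (i ↑ˡ b)) | Σℤ≡sum b (λ j → f (a ↑ʳ j))
    = sum-split a f
    where
    sum-split : ∀ a (f : Fin (a ℕ.+ b) → ℤ) →
                sum f ≡ sum (λ i → f (i ↑ˡ b)) + sum (λ j → f (a ↑ʳ j))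
    sum-split ℕ.zero    f = sym (ℤₚ.+-identityˡ (sum f))
    sum-split (ℕ.suc a) f = trans (cong (_+_ (f zero)) (sum-split a (λ i → f (suc i))))
                                (sym (ℤₚ.+-assoc (f zero) _ _))

  ==-refl : ∀ {k} (x : Fin k) → (x == x) ≡ true
  ==-refl x with x ≟ x
  ... | yes _   = refl
  ... | no x≢x = contradiction refl x≢x

  ==-suc : ∀ {k} (x i : Fin k) → (Fin.suc x == suc i) ≡ (x == i)
  ==-suc x i with x ≟ i
  ... | yes _ = refl
  ... | no _  = refl

  Σℤ-indicator : ∀ k (x : Fin k) (φ : Fin k → ℤ) → Σℤ k (λ i → [ x == i ] * φ i) ≡ φ x
  Σℤ-indicator k x φ = trans (Σℤ≡sum k (λ i → [ x == i ] * φ i)) (sum-indicator x φ)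
    where
    sum-indicator : ∀ {k} (x : Fin k) (φ : Fin k → ℤ) → sum (λ i → [ x == i ] * φ i) ≡ φ x
    sum-indicator {ℕ.suc k} zero φ =
      trans (cong₂ _+_ (ℤₚ.*-identityˡ (φ zero)) (sum-replicate-zero k)) (ℤₚ.+-identityʳ (φ zero))
    sum-indicator {ℕ.suc k} (suc x) φ =
      trans (cong₂ _+_ (ℤₚ.*-zeroˡ (φ zero))
                       (trans (sum-cong-≗ (λ i → cong (λ b → [ b ] * φ (suc i)) (==-suc x i)))
                              (sum-indicator x (λ i → φ (suc i)))))
            (ℤₚ.+-identityˡ (φ (suc x)))

  -- Net outflow of g at v, written exactly as the sum in CircularFlow.conservation.
  ∂ : (H : Graph) → Orientation H → (E H → ℤ) → V H → ℤ
  ∂ H D g v = Σℤ (m H) (λ e → [ tail H D e == v ] * g e - [ head H D e == v ] * g e)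

  module _ (H : Graph) (D : Orientation H) where

    ∂-cong : ∀ {g g′ : E H → ℤ} → (∀ e → g e ≡ g′ e) → ∀ v → ∂ H D g v ≡ ∂ H D g′ v
    ∂-cong g≗g′ v = Σℤ-cong (m H) (λ e →
      cong (λ z → [ tail H D e == v ] * z - [ head H D e == v ] * z) (g≗g′ e))

    ∂-distrib-+ : ∀ (g g′ : E H → ℤ) v →
                  ∂ H D (λ e → g e + g′ e) v ≡ ∂ H D g v + ∂ H D g′ v
    ∂-distrib-+ g g′ v =
      trans (Σℤ-cong (m H) (λ e → distrib [ tail H D e == v ] [ head H D e == v ] (g e) (g′ e)))
            (Σℤ-distrib-+ (m H) _ _)
      where
      distrib : ∀ (a b x y : ℤ) → a * (x + y) - b * (x + y) ≡ (a * x - b * x) + (a * y - b * y)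
      distrib = solve-∀

    ∂-*ˡ : ∀ c (g : E H → ℤ) v → ∂ H D (λ e → c * g e) v ≡ c * ∂ H D g v
    ∂-*ˡ c g v =
      trans (Σℤ-cong (m H) (λ e → pull c [ tail H D e == v ] [ head H D e == v ] (g e)))
            (Σℤ-*ˡ (m H) c _)
      where
      pull : ∀ (c a b x : ℤ) → a * (c * x) - b * (c * x) ≡ c * (a * x - b * x)
      pull = solve-∀

    ∂-neg : ∀ (g : E H → ℤ) v → ∂ H D (λ e → - g e) v ≡ - ∂ H D g v
    ∂-neg g v = trans (∂-cong (λ e → sym (ℤₚ.-1*i≡-i (g e))) v)
                      (trans (∂-*ˡ -1ℤ g v) (ℤₚ.-1*i≡-i (∂ H D g v)))

    ∂-const : ∀ c v → ∂ H D (λ _ → c) v ≡ c * netOut H D v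
    ∂-const c v =
      trans (Σℤ-cong (m H) (λ e → i*k-j*k≡k*[i-j] [ tail H D e == v ] [ head H D e == v ] c))
            (Σℤ-*ˡ (m H) c _)

    ∂-indicator : ∀ x v → ∂ H D (λ e → [ x == e ]) v ≡ [ tail H D x == v ] - [ head H D x == v ]
    ∂-indicator x v =
      trans (Σℤ-cong (m H) (λ e → i*k-j*k≡k*[i-j] [ tail H D e == v ] [ head H D e == v ] [ x == e ]))
            (Σℤ-indicator (m H) x (λ e → [ tail H D e == v ] - [ head H D e == v ]))

  forward : (H : Graph) → Orientation H
  forward H _ = true

  orient : Bool → ℤ → ℤ
  orient true  z = z
  orient false z = - z

  ∂-reorient : ∀ H D (g : E H → ℤ) v → ∂ H D g v ≡ ∂ H (forward H) (λ e → orient (D e) (g e)) v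
  ∂-reorient H D g v = Σℤ-cong (m H) (λ e → reorient (D e) (ends H e) (g e))
    where
    reorient : ∀ b (p : V H × V H) z →
      [ (if b then proj₁ p else proj₂ p) == v ] * z - [ (if b then proj₂ p else proj₁ p) == v ] * z
        ≡ [ proj₁ p == v ] * orient b z - [ proj₂ p == v ] * orient b z
    reorient true  p z = refl
    reorient false p z = swap [ proj₂ p == v ] [ proj₁ p == v ] z
      where
      swap : ∀ (a b x : ℤ) → a * x - b * x ≡ b * - x - a * - x
      swap = solve-∀

  ∂-double : ∀ G (a : E (double G) → ℤ) v →
             ∂ (double G) (forward (double G)) a v ≡ ∂ G (forward G) (λ e → a (e ↑ˡ m G) + a (m G ↑ʳ e)) v
  ∂-double G a v = begin
      ∂ (double G) (forward (double G)) a v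
    ≡⟨ Σℤ-split (m G) (m G) _ ⟩
      Σℤ (m G) (λ e → at (a (e ↑ˡ m G)) (ends (double G) (e ↑ˡ m G)))
        + Σℤ (m G) (λ e → at (a (m G ↑ʳ e)) (ends (double G) (m G ↑ʳ e)))
    ≡⟨ cong₂ _+_ (Σℤ-cong (m G) (λ e → cong (at (a (e ↑ˡ m G))) (ends-↑ˡ e)))
                 (Σℤ-cong (m G) (λ e → cong (at (a (m G ↑ʳ e))) (ends-↑ʳ e))) ⟩
      ∂ G (forward G) (λ e → a (e ↑ˡ m G)) v + ∂ G (forward G) (λ e → a (m G ↑ʳ e)) v
    ≡⟨ ∂-distrib-+ G (forward G) _ _ v ⟨
      ∂ G (forward G) (λ e → a (e ↑ˡ m G) + a (m G ↑ʳ e)) v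
    ∎
    where
    open ≡-Reasoning
    at : ℤ → V G × V G → ℤ
    at z p = [ proj₁ p == v ] * z - [ proj₂ p == v ] * z
    ends-↑ˡ : ∀ e → ends (double G) (e ↑ˡ m G) ≡ ends G e
    ends-↑ˡ e = cong [ ends G , ends G ]′ (splitAt-↑ˡ (m G) e (m G))
    ends-↑ʳ : ∀ e → ends (double G) (m G ↑ʳ e) ≡ ends G e
    ends-↑ʳ e = cong [ ends G , ends G ]′ (splitAt-↑ʳ (m G) (m G) e)

  collapse : ∀ G → Orientation (double G) → (E (double G) → ℤ) → E G → ℤ
  collapse G D g e = orient (D (e ↑ˡ m G)) (g (e ↑ˡ m G)) + orient (D (m G ↑ʳ e)) (g (m G ↑ʳ e))

  ∂-collapse : ∀ G D (g : E (double G) → ℤ) v → ∂ G (forward G) (collapse G D g) v ≡ ∂ (double G) D g v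
  ∂-collapse G D g v = trans (sym (∂-double G _ v)) (sym (∂-reorient (double G) D g v))

  ∣orient∣ : ∀ b z → ∣ orient b z ∣ ≡ ∣ z ∣
  ∣orient∣ true  z = refl
  ∣orient∣ false z = ℤₚ.∣-i∣≡∣i∣ z

  ∣collapse∣≤ : ∀ G D (g : E (double G) → ℤ) {L} → (∀ x → ∣ g x ∣ ℕ.≤ L) →
                ∀ e → ∣ collapse G D g e ∣ ℕ.≤ L ℕ.+ L
  ∣collapse∣≤ G D g ∣g∣≤L e =
    ℕₚ.≤-trans (ℤₚ.∣i+j∣≤∣i∣+∣j∣ (orient (D x₁) (g x₁)) (orient (D x₂) (g x₂)))
               (ℕₚ.+-mono-≤ (bound x₁) (bound x₂))
    where
    x₁ x₂ : E (double G)
    x₁ = e ↑ˡ m G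
    x₂ = m G ↑ʳ e
    bound : ∀ x → ∣ orient (D x) (g x) ∣ ℕ.≤ _
    bound x = ℕₚ.≤-trans (ℕₚ.≤-reflexive (∣orient∣ (D x) (g x))) (∣g∣≤L x)

  -- a ≡ b [mod M ] unfolds to divisibility of ∣ a - b ∣ in ℕ, from which a and b cannot be
  -- inferred; hence the explicit arguments of the lemmas below.
  ≡-mod-intro : ∀ M a b q → a - b ≡ q * + M → a ≡ b [mod M ]
  ≡-mod-intro M a b q eq = Signed.∣⇒∣ᵤ {+ M} {a - b} (Signed.divides q eq)

  ≡-mod-refl : ∀ M a → a ≡ a [mod M ]
  ≡-mod-refl M a = ≡-mod-intro M a a (+ 0) (trans (ℤₚ.+-inverseʳ a) (sym (ℤₚ.*-zeroˡ (+ M))))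

  ≡-mod-sym : ∀ M a b → a ≡ b [mod M ] → b ≡ a [mod M ]
  ≡-mod-sym M a b a≡b = Signed.∣⇒∣ᵤ {+ M} {b - a}
    (subst (Signed._∣_ (+ M)) (negate a b) (Signed.∣m⇒∣-m (Signed.∣ᵤ⇒∣ {+ M} {a - b} a≡b)))
    where
    negate : ∀ (a b : ℤ) → - (a - b) ≡ b - a
    negate = solve-∀

  ≡-mod-trans : ∀ M a b c → a ≡ b [mod M ] → b ≡ c [mod M ] → a ≡ c [mod M ]
  ≡-mod-trans M a b c a≡b b≡c = Signed.∣⇒∣ᵤ {+ M} {a - c}
    (subst (Signed._∣_ (+ M)) ([i-j]+[j-k]≡i-k a b c)
      (Signed.∣m∣n⇒∣m+n (Signed.∣ᵤ⇒∣ {+ M} {a - b} a≡b) (Signed.∣ᵤ⇒∣ {+ M} {b - c} b≡c)))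

  ≡-mod-setoid : ℕ → Setoid 0ℓ 0ℓ
  ≡-mod-setoid M = record
    { Carrier       = ℤ
    ; _≈_           = λ a b → a ≡ b [mod M ]
    ; isEquivalence = record
      { refl  = λ {a} → ≡-mod-refl M a
      ; sym   = λ {a} {b} → ≡-mod-sym M a b
      ; trans = λ {a} {b} {c} → ≡-mod-trans M a b c
      }
    }

  ≡-mod-+ : ∀ M a b c d → a ≡ b [mod M ] → c ≡ d [mod M ] → (a + c) ≡ (b + d) [mod M ]
  ≡-mod-+ M a b c d a≡b c≡d = Signed.∣⇒∣ᵤ {+ M} {(a + c) - (b + d)}
    (subst (Signed._∣_ (+ M)) (regroup a b c d)
      (Signed.∣m∣n⇒∣m+n (Signed.∣ᵤ⇒∣ {+ M} {a - b} a≡b) (Signed.∣ᵤ⇒∣ {+ M} {c - d} c≡d)))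
    where
    regroup : ∀ (a b c d : ℤ) → (a - b) + (c - d) ≡ (a + c) - (b + d)
    regroup = solve-∀

  ≡-mod-*ˡ : ∀ c {M a b} → a ≡ b [mod M ] → (+ c * a) ≡ (+ c * b) [mod (c ℕ.* M) ]
  ≡-mod-*ˡ c {M} {a} {b} a≡b =
    subst₂ _∣_ (sym (ℤₚ.pos-* c M)) (distrib (+ c) a b) (*-monoʳ-∣ (+ c) {+ M} {a - b} a≡b)
    where
    distrib : ∀ (c a b : ℤ) → c * (a - b) ≡ c * a - c * b
    distrib = solve-∀

  multiple≡0 : ∀ M a → (+ M * a) ≡ + 0 [mod M ]
  multiple≡0 M a = ≡-mod-intro M (+ M * a) (+ 0) a (trans (ℤₚ.+-identityʳ (+ M * a)) (ℤₚ.*-comm (+ M) a))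

  isPositive : Sign → ℤ
  isPositive Sign.+ = + 1
  isPositive Sign.- = + 0

  edgeGraph : (G : Graph) → E G → Graph
  edgeGraph G e = record { n = n G ; m = 1 ; ends = λ _ → ends G e ; loopless = λ _ → loopless G e }

  pplus-edgeGraph : ∀ G e v s → pplus (edgeGraph G e) (λ _ → s) v
                    ≡ isPositive s * ([ proj₁ (ends G e) == v ] + [ proj₂ (ends G e) == v ])
  pplus-edgeGraph G e v Sign.+ = ℤₚ.+-identityʳ _
  pplus-edgeGraph G e v Sign.- = ℤₚ.+-identityʳ _

  -- The sign indicator inside pplus is local to its definition in Defs, so σ e cannot be
  -- case-split there directly; the contribution of a single edge is a pplus of its own.
  pplus≡Σℤ : ∀ G (σ : Signature G) v → pplus G σ v
             ≡ Σℤ (m G) (λ e → isPositive (σ e) * ([ proj₁ (ends G e) == v ] + [ proj₂ (ends G e) == v ]))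
  pplus≡Σℤ G σ v = Σℤ-cong (m G) (λ e →
    trans (sym (ℤₚ.+-identityʳ _)) (pplus-edgeGraph G e v (σ e)))

  ∂-isPositive≡pplus : ∀ G (σ : Signature G) v →
                       ∂ G (forward G) (λ e → isPositive (σ e)) v ≡ pplus G σ v [mod 2 ]
  ∂-isPositive≡pplus G σ v = ≡-mod-intro 2 net (pplus G σ v) (- entering) (begin
      net - pplus G σ v
    ≡⟨ cong (_-_ net) (pplus≡Σℤ G σ v) ⟩
      net - Σℤ (m G) (λ e → isPositive (σ e) * ([ end₁ e ] + [ end₂ e ]))
    ≡⟨ cong (_-_ net) (Σℤ-cong (m G) (λ e → split (isPositive (σ e)) [ end₁ e ] [ end₂ e ])) ⟩
      net - Σℤ (m G) (λ e → ([ end₁ e ] * isPositive (σ e) - [ end₂ e ] * isPositive (σ e))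
                            + + 2 * ([ end₂ e ] * isPositive (σ e)))
    ≡⟨ cong (_-_ net) (trans (Σℤ-distrib-+ (m G) _ _) (cong (_+_ net) (Σℤ-*ˡ (m G) (+ 2) _))) ⟩
      net - (net + + 2 * entering)
    ≡⟨ cancel net entering ⟩
      - entering * + 2
    ∎)
    where
    open ≡-Reasoning
    end₁ end₂ : E G → Bool
    end₁ e = proj₁ (ends G e) == v
    end₂ e = proj₂ (ends G e) == v
    net entering : ℤ
    net = ∂ G (forward G) (λ e → isPositive (σ e)) v
    entering = Σℤ (m G) (λ e → [ end₂ e ] * isPositive (σ e))
    split : ∀ (p a b : ℤ) → p * (a + b) ≡ (a * p - b * p) + + 2 * (b * p)
    split = solve-∀
    cancel : ∀ (x y : ℤ) → x - (x + + 2 * y) ≡ - y * + 2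
    cancel = solve-∀

  ∉⇒lookup≡false : ∀ {k} {x : Fin k} (U : Subset k) → x ∉ U → lookup U x ≡ false
  ∉⇒lookup≡false {x = x} U x∉U with lookup U x in eq
  ... | true  = contradiction (lookup⇒[]= x U eq) x∉U
  ... | false = refl

  lookup≡false⇒∉ : ∀ {k} {x : Fin k} (U : Subset k) → lookup U x ≡ false → x ∉ U
  lookup≡false⇒∉ U eq x∈U with trans (sym ([]=⇒lookup x∈U)) eq
  ... | ()

  upper-bound : ∀ {k} (f : Fin k → ℕ) → ∃[ L ] (∀ i → f i ℕ.≤ L)
  upper-bound {ℕ.zero}  f = 0 , λ ()
  upper-bound {ℕ.suc k} f with upper-bound (λ i → f (suc i))
  ... | L , f≤L = f zero ℕ.⊔ L , λ
    { zero    → ℕₚ.m≤m⊔n (f zero) L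
    ; (suc i) → ℕₚ.≤-trans (f≤L i) (ℕₚ.m≤n⊔m (f zero) L)
    }

  pos-∸ : ∀ {m n} → n ℕ.≤ m → + (m ℕ.∸ n) ≡ + m - + n
  pos-∸ {m} {n} n≤m = trans (sym (ℤₚ.⊖-≥ n≤m)) (sym (ℤₚ.m-n≡m⊖n m n))

  record ScaledFlow (H : Graph) (D : Orientation H) : Set where
    field
      bound    : ℕ
      value    : E H → ℕ
      value≤   : ∀ x → value x ℕ.≤ bound
      boundary : ∀ v → ∂ H D (λ x → + value x) v ≡ + ℕ.suc bound * netOut H D v

  module Walks (H : Graph) (D : Orientation H) where

    -- A directed walk is recorded only by how often it traverses each edge, which determines
    -- its boundary; closed walks thereby become circulations.
    record Walk (u w : V H) : Set where
      field
        visits   : E H → ℕ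
        boundary : ∀ v → ∂ H D (λ e → + visits e) v ≡ [ u == v ] - [ w == v ]

    record Circulation : Set where
      field
        flow     : E H → ℕ
        balanced : ∀ v → ∂ H D (λ e → + flow e) v ≡ + 0

    open Walk public
    open Circulation public

    stay : ∀ u → Walk u u
    stay u = record
      { visits   = λ _ → 0
      ; boundary = λ v → trans (∂-const H D (+ 0) v) (sym (ℤₚ.+-inverseʳ [ u == v ]))
      }

    step : ∀ x → Walk (tail H D x) (head H D x)
    step x = record
      { visits   = λ e → if x == e then 1 else 0
      ; boundary = λ v → trans (∂-cong H D (λ e → if-float +_ (x == e)) v) (∂-indicator H D x v)
      }

    step-visits : ∀ x → visits (step x) x ≡ 1
    step-visits x = cong (λ b → if b then 1 else 0) (==-refl x)

    _▸_ : ∀ {u w z} → Walk u w → Walk w z → Walk u z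
    _▸_ {u} {w} {z} p p′ = record
      { visits   = λ e → visits p e ℕ.+ visits p′ e
      ; boundary = λ v → trans (∂-distrib-+ H D _ _ v)
                               (trans (cong₂ _+_ (boundary p v) (boundary p′ v))
                                      ([i-j]+[j-k]≡i-k [ u == v ] [ w == v ] [ z == v ]))
      }

    close : ∀ {u} → Walk u u → Circulation
    close {u} p = record
      { flow     = visits p
      ; balanced = λ v → trans (boundary p v) (ℤₚ.+-inverseʳ [ u == v ])
      }

    ∅ : Circulation
    ∅ = record { flow = λ _ → 0 ; balanced = ∂-const H D (+ 0) }

    _⊕_ : Circulation → Circulation → Circulation
    c ⊕ c′ = record
      { flow     = λ e → flow c e ℕ.+ flow c′ e
      ; balanced = λ v → trans (∂-distrib-+ H D _ _ v) (cong₂ _+_ (balanced c v) (balanced c′ v))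
      }

    module _ (strong : StronglyConnected H D) where

      -- U holds the vertices not yet known to be reachable from u; strong connectivity yields an
      -- edge from a reached vertex into U, so each round removes its head from U.
      search : ∀ {u} t (U : Subset (n H)) → ∣ U ∣ₛ ℕ.< t → u ∉ U →
               (∀ z → z ∉ U → Walk u z) → ∀ w → Walk u w
      search ℕ.zero U () u∉U reached w
      search {u} (ℕ.suc t) U (ℕ.s≤s ∣U∣≤t) u∉U reached w with w ∈? U
      ... | no w∉U = reached w w∉U
      ... | yes w∈U with proj₂ (strong (lookup U) (w , []=⇒lookup w∈U) (u , ∉⇒lookup≡false U u∉U))
      ...   | x , tail∉U , head∈U =
        search t (U ∖ head H D x) (ℕₚ.≤-trans (x∈p⇒∣p-x∣<∣p∣ (lookup⇒[]= (head H D x) U head∈U)) ∣U∣≤t)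
               (λ u∈U′ → u∉U (p─q⊆p U ⁅ head H D x ⁆ u∈U′)) reached′ w
        where
        reached′ : ∀ z → z ∉ U ∖ head H D x → Walk u z
        reached′ z z∉U′ with z ≟ head H D x
        ... | yes refl = reached (tail H D x) (lookup≡false⇒∉ U tail∉U) ▸ step x
        ... | no z≢y   = reached z (λ z∈U → z∉U′ (x∈p∧x≢y⇒x∈p-y z∈U z≢y))

      reachable : ∀ u w → Walk u w
      reachable u = search (ℕ.suc ∣ ∁ ⁅ u ⁆ ∣ₛ) (∁ ⁅ u ⁆) ℕₚ.≤-refl (x∈p⇒x∉∁p (x∈⁅x⁆ u)) reached₀
        where
        reached₀ : ∀ z → z ∉ ∁ ⁅ u ⁆ → Walk u z
        reached₀ z z∉U₀ = subst (Walk u) (sym (x∈⁅y⁆⇒x≡y u (x∉∁p⇒x∈p z∉U₀))) (stay u)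

      positive-circulation : Σ[ c ∈ Circulation ] (∀ x → 1 ℕ.≤ flow c x)
      positive-circulation = c , λ x → All.lookup covers (∈-allFin x)
        where
        through : ∀ x → Σ[ c ∈ Circulation ] 1 ℕ.≤ flow c x
        through x = close (step x ▸ reachable (head H D x) (tail H D x)) ,
                    ℕₚ.≤-trans (ℕₚ.≤-reflexive (sym (step-visits x))) (ℕₚ.m≤m+n _ _)
        cover : (xs : List (E H)) → Σ[ c ∈ Circulation ] All (λ x → 1 ℕ.≤ flow c x) xs
        cover []       = ∅ , []
        cover (x ∷ xs) with through x | cover xs
        ... | c₁ , 1≤c₁x | c₂ , 1≤c₂ = c₁ ⊕ c₂ ,
          ℕₚ.≤-trans 1≤c₁x (ℕₚ.m≤m+n _ _) ∷ All.map (λ 1≤c₂y → ℕₚ.≤-trans 1≤c₂y (ℕₚ.m≤n+m _ _)) 1≤c₂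
        c : Circulation
        c = proj₁ (cover (allFin (m H)))
        covers : All (λ x → 1 ℕ.≤ flow c x) (allFin (m H))
        covers = proj₂ (cover (allFin (m H)))

      -- The constant flow N has boundary N · netOut; subtracting a circulation c with
      -- 1 ≤ c ≤ N keeps that boundary and leaves every value in [0, N - 1].
      scaled-flow : ScaledFlow H D
      scaled-flow with positive-circulation
      ... | c , 1≤c with upper-bound (flow c)
      ... | L , c≤L = record
        { bound    = L
        ; value    = λ x → ℕ.suc L ℕ.∸ flow c x
        ; value≤   = λ x → ℕₚ.∸-monoʳ-≤ (ℕ.suc L) (1≤c x)
        ; boundary = ∂g≡
        }
        where
        open ≡-Reasoning
        ∂g≡ : ∀ v → ∂ H D (λ x → + (ℕ.suc L ℕ.∸ flow c x)) v ≡ + ℕ.suc L * netOut H D v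
        ∂g≡ v = begin
            ∂ H D (λ x → + (ℕ.suc L ℕ.∸ flow c x)) v
          ≡⟨ ∂-cong H D (λ x → pos-∸ (ℕₚ.m≤n⇒m≤1+n (c≤L x))) v ⟩
            ∂ H D (λ x → + ℕ.suc L - + flow c x) v
          ≡⟨ ∂-distrib-+ H D _ _ v ⟩
            ∂ H D (λ _ → + ℕ.suc L) v + ∂ H D (λ x → - + flow c x) v
          ≡⟨ cong₂ _+_ (∂-const H D (+ ℕ.suc L) v) (trans (∂-neg H D _ v) (cong -_ (balanced c v))) ⟩
            + ℕ.suc L * netOut H D v + - + 0
          ≡⟨ ℤₚ.+-identityʳ _ ⟩
            + ℕ.suc L * netOut H D v
          ∎

  -- With h = 2kN: N · b ≡ N · 2k · p⁺ = h · p⁺ and h · ∂(isPositive ∘ σ) ≡ h · p⁺ modulo 2h.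
  shift-balanced : ∀ G (σ : Signature G) k N (y : E G → ℤ) (b : V G → ℤ) →
    (∀ v → ∂ G (forward G) y v ≡ + N * b v) →
    (∀ v → b v ≡ + (2 ℕ.* k) * pplus G σ v [mod (4 ℕ.* k) ]) →
    ∀ v → ∂ G (forward G) (λ e → y e + + (2 ℕ.* k ℕ.* N) * isPositive (σ e)) v
            ≡ + 0 [mod (2 ℕ.* (2 ℕ.* k ℕ.* N)) ]
  shift-balanced G σ k N y b ∂y≡Nb b≡2kp v = begin
      ∂ G (forward G) (λ e → y e + + h * isPositive (σ e)) v  ≡⟨ split ⟩
      Nb + hP                                               ≈⟨ ≡-mod-+ _ Nb N2kp hP hp scaled-b scaled-P ⟩
      N2kp + hp                                             ≡⟨ collect ⟩
      + (2 ℕ.* h) * p                                       ≈⟨ multiple≡0 (2 ℕ.* h) p ⟩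
      + 0                                                   ∎
    where
    h : ℕ
    h = 2 ℕ.* k ℕ.* N
    open SetoidReasoning (≡-mod-setoid (2 ℕ.* h))
    p P Nb N2kp hP hp : ℤ
    p = pplus G σ v
    P = ∂ G (forward G) (λ e → isPositive (σ e)) v
    Nb = + N * b v
    N2kp = + N * (+ (2 ℕ.* k) * p)
    hP = + h * P
    hp = + h * p
    split : ∂ G (forward G) (λ e → y e + + h * isPositive (σ e)) v ≡ Nb + hP
    split = trans (∂-distrib-+ G (forward G) y _ v)
                  (cong₂ _+_ (∂y≡Nb v) (∂-*ˡ G (forward G) (+ h) _ v))
    scaled-b : Nb ≡ N2kp [mod (2 ℕ.* h) ]
    scaled-b = subst (λ M → Nb ≡ N2kp [mod M ])
                     (4kN≡2h k N) (≡-mod-*ˡ N (b≡2kp v))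
      where
      4kN≡2h : ∀ k N → N ℕ.* (4 ℕ.* k) ≡ 2 ℕ.* (2 ℕ.* k ℕ.* N)
      4kN≡2h = ℕ-solve-∀
    scaled-P : hP ≡ hp [mod (2 ℕ.* h) ]
    scaled-P = subst (λ M → hP ≡ hp [mod M ])
                     (ℕₚ.*-comm h 2) (≡-mod-*ˡ h (∂-isPositive≡pplus G σ v))
    collect : N2kp + hp ≡ + (2 ℕ.* h) * p
    collect = trans (cong (λ z → N2kp + z * p) (ℤₚ.pos-* (2 ℕ.* k) N))
                    (trans (twice (+ (2 ℕ.* k)) (+ N) p)
                           (cong (_* p) (sym (trans (ℤₚ.pos-* 2 h)
                                                    (cong (_*_ (+ 2)) (ℤₚ.pos-* (2 ℕ.* k) N))))))
      where
      twice : ∀ (X Y p : ℤ) → Y * (X * p) + (X * Y) * p ≡ (+ 2 * (X * Y)) * p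
      twice = solve-∀

  window⁻ : ∀ {h q r} (y : ℤ) → q ℕ.+ r ≡ h → ∣ y ∣ ℕ.≤ r → + ∣ y ∣ ≤ + h - + q
  window⁻ {q = q} {r} y refl ∣y∣≤r = subst (+ ∣ y ∣ ≤_) (sym (i+j-i≡j (+ q) (+ r))) (+≤+ ∣y∣≤r)

  window⁺ : ∀ {h q r} (y : ℤ) → q ℕ.+ r ≡ h → ∣ y ∣ ℕ.≤ r →
            (+ q ≤ + ∣ y + + h ∣) × (+ ∣ y + + h ∣ ≤ + (2 ℕ.* h) - + q)
  window⁺ {h} {q} {r} y refl ∣y∣≤r = +≤+ lower , subst (+ ∣ y + + h ∣ ≤_) (sym top) (+≤+ upper)
    where
    open ℕₚ.≤-Reasoning
    lower : q ℕ.≤ ∣ y + + h ∣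
    lower = ℕₚ.+-cancelʳ-≤ r q ∣ y + + h ∣ (begin
        q ℕ.+ r                ≡⟨ cong ∣_∣ (i+j-i≡j y (+ h)) ⟨
        ∣ (y + + h) - y ∣      ≤⟨ ℤₚ.∣i-j∣≤∣i∣+∣j∣ (y + + h) y ⟩
        ∣ y + + h ∣ ℕ.+ ∣ y ∣  ≤⟨ ℕₚ.+-monoʳ-≤ ∣ y + + h ∣ ∣y∣≤r ⟩
        ∣ y + + h ∣ ℕ.+ r      ∎)
    upper : ∣ y + + h ∣ ℕ.≤ r ℕ.+ h
    upper = ℕₚ.≤-trans (ℤₚ.∣i+j∣≤∣i∣+∣j∣ y (+ h)) (ℕₚ.+-monoˡ-≤ h ∣y∣≤r)
    top : + (2 ℕ.* h) - + q ≡ + (r ℕ.+ h)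
    top = trans (cong (λ z → + z - + q) (twice q r)) (i+j-i≡j (+ q) (+ (r ℕ.+ h)))
      where
      twice : ∀ q r → 2 ℕ.* (q ℕ.+ r) ≡ q ℕ.+ (r ℕ.+ (q ℕ.+ r))
      twice = ℕ-solve-∀

  shift⇒circular-flow : ∀ G (σ : Signature G) {h q r} → q ℕ.+ r ≡ h →
    (y : E G → ℤ) → (∀ e → ∣ y e ∣ ℕ.≤ r) →
    (∀ v → ∂ G (forward G) (λ e → y e + + h * isPositive (σ e)) v ≡ + 0 [mod (2 ℕ.* h) ]) →
    CircularFlow G σ h q
  shift⇒circular-flow G σ {h} {q} q+r≡h y ∣y∣≤r balanced = record
    { D            = forward G
    ; f            = λ e → y e + + h * isPositive (σ e)
    ; positive     = positive
    ; negative     = negative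
    ; conservation = balanced
    }
    where
    positive : ∀ e → σ e ≡ Sign.+ →
      (+ q ≤ + ∣ y e + + h * isPositive (σ e) ∣) × (+ ∣ y e + + h * isPositive (σ e) ∣ ≤ + (2 ℕ.* h) - + q)
    positive e σe≡+ rewrite σe≡+ | ℤₚ.*-identityʳ (+ h) = window⁺ (y e) q+r≡h (∣y∣≤r e)
    negative : ∀ e → σ e ≡ Sign.- →
      (+ ∣ y e + + h * isPositive (σ e) ∣ ≤ + h - + q)
        ⊎ ((+ h + + q ≤ + ∣ y e + + h * isPositive (σ e) ∣)
           × (+ ∣ y e + + h * isPositive (σ e) ∣ ≤ + (2 ℕ.* h) - + 1))
    negative e σe≡- rewrite σe≡- | ℤₚ.*-zeroʳ (+ h) | ℤₚ.+-identityʳ (y e) =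
      inj₁ (window⁻ (y e) q+r≡h (∣y∣≤r e))

  scaled-flow⇒φc< : ∀ K G (σ : Signature G) D → ScaledFlow (double G) D →
    (∀ v → netOut (double G) D v ≡ + (2 ℕ.* ℕ.suc K) * pplus G σ v [mod (4 ℕ.* ℕ.suc K) ]) →
    (φc< (2 ℕ.* ℕ.suc K) / K) G σ
  scaled-flow⇒φc< K G σ D F netOut≡2kp⁺ =
    h , q , ℕ.s≤s ℕ.z≤n , ℕ.s≤s ℕ.z≤n , ratio K N ,
    shift⇒circular-flow G σ (q+r≡h K L) y
      (λ e → ℕₚ.m≤n⇒m≤1+n (∣collapse∣≤ G D (λ x → + value x) value≤ e))
      (shift-balanced G σ (ℕ.suc K) N y (netOut (double G) D) ∂y≡ netOut≡2kp⁺)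
    where
    open ScaledFlow F renaming (bound to L)
    N h q : ℕ
    N = ℕ.suc L
    h = 2 ℕ.* ℕ.suc K ℕ.* N
    q = ℕ.suc (2 ℕ.* K ℕ.* N)
    y : E G → ℤ
    y = collapse G D (λ x → + value x)
    ∂y≡ : ∀ v → ∂ G (forward G) y v ≡ + N * netOut (double G) D v
    ∂y≡ v = trans (∂-collapse G D _ v) (boundary v)
    q+r≡h : ∀ K L → ℕ.suc (2 ℕ.* K ℕ.* ℕ.suc L) ℕ.+ ℕ.suc (L ℕ.+ L) ≡ 2 ℕ.* ℕ.suc K ℕ.* ℕ.suc L
    q+r≡h = ℕ-solve-∀
    ratio : ∀ K N → 2 ℕ.* (2 ℕ.* ℕ.suc K ℕ.* N) ℕ.* K ℕ.< 2 ℕ.* ℕ.suc K ℕ.* ℕ.suc (2 ℕ.* K ℕ.* N)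
    ratio K N = subst (2 ℕ.* (2 ℕ.* ℕ.suc K ℕ.* N) ℕ.* K ℕ.<_) (sym (expand K N))
                      (ℕₚ.m<m+n _ (ℕ.s≤s ℕ.z≤n))
      where
      expand : ∀ K N → 2 ℕ.* ℕ.suc K ℕ.* ℕ.suc (2 ℕ.* K ℕ.* N)
                       ≡ 2 ℕ.* (2 ℕ.* ℕ.suc K ℕ.* N) ℕ.* K ℕ.+ 2 ℕ.* ℕ.suc K
      expand = ℕ-solve-∀

open Flows using (scaled-flow⇒φc<; ≡-mod-trans; module Walks)

open import Data.Nat using (ℕ; suc; _≤_; _∸_; _*_; s≤s)
open import Data.Integer using (ℤ; +_)
open import Data.Product using (∃-syntax; _×_; _,_)

theorem2p8 : (k : ℕ) → 2 ≤ k → (G : Graph) → (σ : Signature G) →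
    (β : V G → ℤ) → PCBoundary (2 * k) (double G) β →
    (∀ v → β v ≡ + (2 * k) Data.Integer.* pplus G σ v [mod (4 * k) ]) →
    (∃[ D ] (IsBetaOrientation (4 * k) (double G) β D × StronglyConnected (double G) D)) →
    (φc< (2 * k) / (k ∸ 1)) G σ
theorem2p8 (suc K) (s≤s _) G σ β _ β≡2kp⁺ (D , D-β , D-strong) =
  scaled-flow⇒φc< K G σ D (Walks.scaled-flow (double G) D D-strong) (λ v →
    ≡-mod-trans (4 * suc K) (netOut (double G) D v) (β v) (+ (2 * suc K) Data.Integer.* pplus G σ v)
                (D-β v) (β≡2kp⁺ v))
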